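{- Let $a\geq 4$ and $m\geq a^2-a+2$ be integers, let $C(m,a)=\left\lceil\frac{m-1}{a}\left\lceil\frac{m-1}{a}\right\rceil\right\rceil$, and suppose the set $\{1,\dots,C(m,a)\}$ is colored red and blue so that there is no solution of $x_1+\cdots+x_{m-1}=ax_m$ with all $x_i\in\{1,\dots,C(m,a)\}$ of the same color. Suppose further that $a-2$ and $a-1$ are both red. Then the numbers $m-a, m-a+1,\dots,m-1$ are all blue.
   Context: Solutions need not have distinct entries. -}

module Defs where

open import Data.Nat using (ℕ; zero; suc; _+_; _*_; _∸_; _≤_; _/_; NonZero)
open import Data.Fin using (Fin) renaming (zero to fzero; suc to fsuc)
open import Data.Bool using (Bool)
open import Data.Product using (_×_; Σ; ∃-syntax)
open import Relation.Binary.PropositionalEquality using (_≡_)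

⌈_/_⌉ : (p q : ℕ) → .{{NonZero q}} → ℕ
⌈ p / q ⌉ = (p + q ∸ 1) / q

Σ[<_] : (n : ℕ) → (Fin n → ℕ) → ℕ
Σ[< zero ] x = 0
Σ[< suc n ] x = x fzero + Σ[< n ] (λ i → x (fsuc i))

-- C(m,a) = ⌈ ((m-1)/a) · ⌈ (m-1)/a ⌉ ⌉ = ⌈ (m-1)·⌈(m-1)/a⌉ / a ⌉
C : (m a : ℕ) → .{{NonZero a}} → ℕ
C m a = ⌈ (m ∸ 1) * ⌈ (m ∸ 1) / a ⌉ / a ⌉

-- a 2-colouring (only values on 1..N matter)
Colouring : Set
Colouring = ℕ → Bool

-- a monochromatic solution of x_1+...+x_{m-1} = a x_m inside {1,...,N}:
-- xs are x_1..x_{m-1}, y is x_m.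
MonoSolution : (N m a : ℕ) → Colouring → Set
MonoSolution N m a c =
  Σ (Fin (m ∸ 1) → ℕ) λ xs → Σ ℕ λ y → ∃[ col ]
    ( ((i : Fin (m ∸ 1)) → 1 ≤ xs i × xs i ≤ N × c (xs i) ≡ col)
    × (1 ≤ y × y ≤ N × c y ≡ col)
    × Σ[< m ∸ 1 ] xs ≡ a * y )

-- A red a - 2 and a red a - 1 can be mixed to hit any total between their
-- extremes.  For m - a ≤ k ≤ m - 2, take x₁ = x_m = k and fill the other m - 2
-- summands with a - 2's and a - 1's summing to (a - 1) k; the bound
-- m ≥ a² - a + 2 makes (a - 1) k land between (m - 2)(a - 2) and (m - 2)(a - 1).
-- For k = m - 1, take x₁ = x₂ = x_m = m - 1 and m - 3 summands summing to
-- (a - 2)(m - 1).  Either way a red k yields a red solution, since every number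
-- involved is at most m - 1 ≤ C(m, a).
module Submission where

open import Defs
open import Data.Nat using (ℕ; zero; suc; _+_; _*_; _∸_; _≤_; _<_; _/_; NonZero; z≤n; s≤s; >-nonZero⁻¹)
open import Data.Nat.Properties
open import Data.Nat.DivMod using (m*n/n≡m; /-monoˡ-≤)
open import Data.Nat.Tactic.RingSolver using (solve-∀)
open import Data.Bool using (Bool; true; false)
open import Data.Fin using (Fin) renaming (zero to fzero; suc to fsuc)
open import Data.Vec.Functional using (_∷_)
open import Data.Sum using (_⊎_; inj₁; inj₂)
open import Data.Product using (_×_; _,_)
open import Data.Empty using (⊥-elim)
open import Relation.Binary.PropositionalEquality using (_≡_; refl; cong; subst; module ≡-Reasoning)
open import Relation.Nullary using (¬_; contradiction)

⌊/⌋≤⌈/⌉ : ∀ p a .{{_ : NonZero a}} → p / a ≤ ⌈ p / a ⌉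
⌊/⌋≤⌈/⌉ p a = /-monoˡ-≤ a (begin
  p             ≤⟨ m≤m+n p (a ∸ 1) ⟩
  p + (a ∸ 1)   ≡⟨ +-∸-assoc p (>-nonZero⁻¹ a) ⟨
  p + a ∸ 1     ∎)
  where open ≤-Reasoning

*≤⇒≤⌈/⌉ : ∀ {q p a} .{{_ : NonZero a}} → q * a ≤ p → q ≤ ⌈ p / a ⌉
*≤⇒≤⌈/⌉ {q} {p} {a} qa≤p = begin
  q           ≡⟨ m*n/n≡m q a ⟨
  q * a / a   ≤⟨ /-monoˡ-≤ a qa≤p ⟩
  p / a       ≤⟨ ⌊/⌋≤⌈/⌉ p a ⟩
  ⌈ p / a ⌉   ∎
  where open ≤-Reasoning

*<⇒<⌈/⌉ : ∀ {q p a} .{{_ : NonZero a}} → q * a < p → q < ⌈ p / a ⌉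
*<⇒<⌈/⌉ {q} {p} {a} qa<p = begin
  suc q             ≡⟨ m*n/n≡m (suc q) a ⟨
  suc q * a / a     ≡⟨ cong (_/ a) (+-comm a (q * a)) ⟩
  (q * a + a) / a   ≤⟨ /-monoˡ-≤ a (∸-monoˡ-≤ 1 (+-monoˡ-≤ a qa<p)) ⟩
  ⌈ p / a ⌉         ∎
  where open ≤-Reasoning

n≤C[1+n] : ∀ n a → a * suc a < n → n ≤ C (suc n) (suc a)
n≤C[1+n] n a a[a+1]<n = *≤⇒≤⌈/⌉ {n} {n * ⌈ n / suc a ⌉} (*-monoʳ-≤ n (*<⇒<⌈/⌉ a[a+1]<n))

bumped : ℕ → ℕ → {n : ℕ} → Fin n → ℕ
bumped v zero    i        = v
bumped v (suc t) fzero    = suc v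
bumped v (suc t) (fsuc i) = bumped v t i

Σ-bumped : ∀ v {n t} → t ≤ n → Σ[< n ] (bumped v t) ≡ n * v + t
Σ-bumped v {zero}  z≤n       = refl
Σ-bumped v {suc n} {zero} z≤n = begin
  v + Σ[< n ] (bumped v 0)   ≡⟨ cong (v +_) (Σ-bumped v {n} z≤n) ⟩
  v + (n * v + 0)            ≡⟨ +-assoc v (n * v) 0 ⟨
  suc n * v + 0              ∎
  where open ≡-Reasoning
Σ-bumped v {suc n} {suc t} (s≤s t≤n) = begin
  suc v + Σ[< n ] (bumped v t)   ≡⟨ cong (suc v +_) (Σ-bumped v t≤n) ⟩
  suc (v + (n * v + t))          ≡⟨ cong suc (+-assoc v (n * v) t) ⟨
  suc (suc n * v + t)            ≡⟨ +-suc (suc n * v) t ⟨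
  suc n * v + suc t              ∎
  where open ≡-Reasoning

bumped-preserves : ∀ {P : ℕ → Set} {v} → P v → P (suc v) → ∀ t {n} (i : Fin n) → P (bumped v t i)
bumped-preserves Pv Psv zero    i        = Pv
bumped-preserves Pv Psv (suc t) fzero    = Psv
bumped-preserves {P} Pv Psv (suc t) (fsuc i) = bumped-preserves {P} Pv Psv t i

Coloured : ℕ → Colouring → Bool → ℕ → Set
Coloured N c col x = 1 ≤ x × x ≤ N × c x ≡ col

lowerSolution : ∀ {N c col} r n k → r * suc r ≤ n → n ∸ r ≤ k → k ≤ n →
  Coloured N c col r → Coloured N c col (suc r) → Coloured N c col k →
  MonoSolution N (suc (suc n)) (suc (suc r)) c
lowerSolution {N} {c} {col} r n k r[r+1]≤n lo k≤n cr cr' ck =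
  k ∷ bumped r t , k , col , coloured , ck , cong (k +_) sum-bumped
  where
  t = suc r * k ∸ n * r

  coloured : ∀ i → Coloured N c col ((k ∷ bumped r t) i)
  coloured fzero    = ck
  coloured (fsuc i) = bumped-preserves {Coloured N c col} cr cr' t i

  nr≤[r+1]k : n * r ≤ suc r * k
  nr≤[r+1]k = subst (_≤ suc r * k) (*-comm r n) (+-cancelʳ-≤ (r * suc r) (r * n) (suc r * k) (begin
    r * n + r * suc r       ≤⟨ +-monoʳ-≤ (r * n) r[r+1]≤n ⟩
    r * n + n               ≡⟨ +-comm (r * n) n ⟩
    suc r * n               ≤⟨ *-monoʳ-≤ (suc r) (m≤n+m∸n n r) ⟩
    suc r * (r + (n ∸ r))   ≤⟨ *-monoʳ-≤ (suc r) (+-monoʳ-≤ r lo) ⟩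
    suc r * (r + k)         ≡⟨ expand r k ⟩
    suc r * k + r * suc r   ∎))
    where
    open ≤-Reasoning
    expand : ∀ r k → suc r * (r + k) ≡ suc r * k + r * suc r
    expand = solve-∀

  t≤n : t ≤ n
  t≤n = begin
    suc r * k ∸ n * r   ≤⟨ ∸-monoˡ-≤ (n * r) (*-monoʳ-≤ (suc r) k≤n) ⟩
    suc r * n ∸ n * r   ≡⟨ cong (λ x → n + x ∸ n * r) (*-comm r n) ⟩
    n + n * r ∸ n * r   ≡⟨ m+n∸n≡m n (n * r) ⟩
    n                   ∎
    where open ≤-Reasoning

  sum-bumped : Σ[< n ] (bumped r t) ≡ suc r * k
  sum-bumped = begin
    Σ[< n ] (bumped r t)   ≡⟨ Σ-bumped r t≤n ⟩
    n * r + t              ≡⟨ m+[n∸m]≡n nr≤[r+1]k ⟩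
    suc r * k              ∎
    where open ≡-Reasoning

topSolution : ∀ {N c col} r n → r + r < n →
  Coloured N c col r → Coloured N c col (suc r) → Coloured N c col (suc n) →
  MonoSolution N (suc (suc n)) (suc (suc r)) c
topSolution {N} {c} {col} r (suc p) (s≤s 2r≤p) cr cr' cn =
  M ∷ M ∷ bumped r (r + r) , M , col , coloured , cn , cong (λ x → M + (M + x)) sum-bumped
  where
  M = suc (suc p)

  coloured : ∀ i → Coloured N c col ((M ∷ M ∷ bumped r (r + r)) i)
  coloured fzero           = cn
  coloured (fsuc fzero)    = cn
  coloured (fsuc (fsuc i)) = bumped-preserves {Coloured N c col} cr cr' (r + r) i

  sum-bumped : Σ[< p ] (bumped r (r + r)) ≡ r * M
  sum-bumped = begin
    Σ[< p ] (bumped r (r + r))   ≡⟨ Σ-bumped r 2r≤p ⟩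
    p * r + (r + r)              ≡⟨ collect r p ⟩
    r * suc (suc p)              ∎
    where
    open ≡-Reasoning
    collect : ∀ r p → p * r + (r + r) ≡ r * suc (suc p)
    collect = solve-∀

redPair⇒blue : ∀ {N} r n → 2 ≤ r → suc r * suc (suc r) ≤ n → suc n ≤ N → (c : Colouring) →
  ¬ MonoSolution N (suc (suc n)) (suc (suc r)) c → c r ≡ true → c (suc r) ≡ true →
  ∀ k → n ∸ r ≤ k → k ≤ suc n → c k ≡ false
redPair⇒blue {N} r n 2≤r [r+1][r+2]≤n n<N c noSol red red' k lo hi with c k in red-k
... | false = refl
... | true  = ⊥-elim (noSol (solution (m≤n⇒m<n∨m≡n hi)))
  where
  2r<n : r + r < n
  2r<n = <-≤-trans (m≤m+n (suc (r + r)) (r * r + r + 1)) (≤-trans (≤-reflexive (expand r)) [r+1][r+2]≤n)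
    where
    expand : ∀ r → suc (r + r) + (r * r + r + 1) ≡ suc r * suc (suc r)
    expand = solve-∀

  r<n : r < n
  r<n = ≤-<-trans (m≤m+n r r) 2r<n

  n≤N : n ≤ N
  n≤N = ≤-trans (n≤1+n n) n<N

  cr : Coloured N c true r
  cr = ≤-trans (s≤s z≤n) 2≤r , ≤-trans (<⇒≤ r<n) n≤N , red

  cr' : Coloured N c true (suc r)
  cr' = s≤s z≤n , ≤-trans r<n n≤N , red'

  ck : Coloured N c true k
  ck = ≤-trans (m<n⇒0<n∸m r<n) lo , ≤-trans hi n<N , red-k

  solution : k < suc n ⊎ k ≡ suc n → MonoSolution N (suc (suc n)) (suc (suc r)) c
  solution (inj₁ (s≤s k≤n)) = lowerSolution r n k r[r+1]≤n lo k≤n cr cr' ck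
    where
    r[r+1]≤n : r * suc r ≤ n
    r[r+1]≤n = ≤-trans (*-mono-≤ (n≤1+n r) (n≤1+n (suc r))) [r+1][r+2]≤n
  solution (inj₂ k≡1+n) = topSolution r n 2r<n cr cr' (subst (Coloured N c true) k≡1+n ck)

lemma3 : (a m : ℕ) → .{{_ : NonZero a}} → 4 ≤ a → a * a ∸ a + 2 ≤ m →
    (c : Colouring) → ¬ MonoSolution (C m a) m a c →
    c (a ∸ 2) ≡ true → c (a ∸ 1) ≡ true →
    (k : ℕ) → m ∸ a ≤ k → k ≤ m ∸ 1 → c k ≡ false
lemma3 (suc (suc r)) zero          (s≤s (s≤s _))   H = contradiction (m+n≤o⇒n≤o _ {2} H) λ ()
lemma3 (suc (suc r)) (suc zero)    (s≤s (s≤s _))   H = contradiction (m+n≤o⇒n≤o _ {2} H) λ { (s≤s ()) }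
lemma3 (suc (suc r)) (suc (suc n)) (s≤s (s≤s 2≤r)) H =
  redPair⇒blue r n 2≤r [r+1][r+2]≤n (n≤C[1+n] (suc n) (suc r) (s≤s [r+1][r+2]≤n))
  where
  a = suc (suc r)
  [r+1][r+2]≤n : suc r * a ≤ n
  [r+1][r+2]≤n = +-cancelʳ-≤ 2 (suc r * a) n (begin
    suc r * a + 2   ≡⟨ cong (_+ 2) (m+n∸m≡n a (suc r * a)) ⟨
    a * a ∸ a + 2   ≤⟨ H ⟩
    2 + n           ≡⟨ +-comm 2 n ⟩
    n + 2           ∎)
    where open ≤-Reasoning
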